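{- The sign pattern $\begin{bmatrix}0&+&0\\-&0&+\\+&0&+\end{bmatrix}$ requires algebraic positivity.
   Context: For a sign pattern $S$ (matrix with entries in $\{+,-,0\}$), $Q(S)$ is the set of real matrices $X$ with $\mathrm{sgn}(X_{ij})=S_{ij}$ for all $i,j$. A real square matrix $M$ is algebraically positive if there is a real polynomial $p$ with all entries of $p(M)$ positive. $S$ requires algebraic positivity if every $X\in Q(S)$ is algebraically positive. -}

module Defs where

open import Level using (0ℓ)
open import Data.Fin using (Fin; zero; suc)
open import Data.List using (List; []; _∷_)
open import Data.Product using (Σ; ∃; _×_; _,_)
open import Data.Sum using (_⊎_)
open import Relation.Binary.PropositionalEquality using (_≡_)
open import Relation.Nullary using (¬_)
open import Algebra.Structures using (IsCommutativeRing)

-- The real numbers, given axiomatically as a complete ordered field.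
-- (agda-stdlib has no reals; any model of these axioms is isomorphic
-- to ℝ, so quantifying over all models is the same as speaking of ℝ.)

record RealField : Set₁ where
  infixl 6 _+_
  infixl 7 _*_
  infix  4 _<_
  field
    Carrier : Set
    _+_ _*_ : Carrier → Carrier → Carrier
    -_      : Carrier → Carrier
    0# 1#   : Carrier
    _<_     : Carrier → Carrier → Set
    isCommutativeRing : IsCommutativeRing _≡_ _+_ _*_ -_ 0# 1#
    0≢1     : ¬ (0# ≡ 1#)
    inverse : ∀ x → ¬ (x ≡ 0#) → Σ Carrier λ y → x * y ≡ 1#
    <-irrefl : ∀ x → ¬ (x < x)
    <-trans  : ∀ {x y z} → x < y → y < z → x < z
    <-trichotomy : ∀ x y → (x < y) ⊎ ((x ≡ y) ⊎ (y < x))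
    +-mono-< : ∀ {x y} z → x < y → x + z < y + z
    *-pos    : ∀ {x y} → 0# < x → 0# < y → 0# < x * y
    sup : (P : Carrier → Set) → (Σ Carrier P) →
          (Σ Carrier λ b → ∀ x → P x → ¬ (b < x)) →
          Σ Carrier λ s → (∀ x → P x → ¬ (s < x)) ×
                          (∀ b → (∀ x → P x → ¬ (b < x)) → ¬ (b < s))

data Sign : Set where
  ⊕ ⊖ ⊙ : Sign

SignPattern : Set
SignPattern = Fin 3 → Fin 3 → Sign

S₇ : SignPattern
S₇ zero          zero          = ⊙
S₇ zero          (suc zero)    = ⊕
S₇ zero          (suc (suc _)) = ⊙
S₇ (suc zero)    zero          = ⊖
S₇ (suc zero)    (suc zero)    = ⊙
S₇ (suc zero)    (suc (suc _)) = ⊕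
S₇ (suc (suc _)) zero          = ⊕
S₇ (suc (suc _)) (suc zero)    = ⊙
S₇ (suc (suc _)) (suc (suc _)) = ⊕

module _ (ℝ : RealField) where
  open RealField ℝ

  Matrix : Set
  Matrix = Fin 3 → Fin 3 → Carrier

  HasSign : Carrier → Sign → Set
  HasSign x ⊕ = 0# < x
  HasSign x ⊖ = x < 0#
  HasSign x ⊙ = x ≡ 0#

  InQ : SignPattern → Matrix → Set
  InQ S X = ∀ i j → HasSign (X i j) (S i j)

  sum3 : (Fin 3 → Carrier) → Carrier
  sum3 f = f zero + (f (suc zero) + f (suc (suc zero)))

  _⊗_ : Matrix → Matrix → Matrix
  (A ⊗ B) i j = sum3 λ k → A i k * B k j

  _⊕ₘ_ : Matrix → Matrix → Matrix
  (A ⊕ₘ B) i j = A i j + B i j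

  identity : Matrix
  identity zero          zero          = 1#
  identity (suc zero)    (suc zero)    = 1#
  identity (suc (suc _)) (suc (suc _)) = 1#
  identity _             _             = 0#

  scalar : Carrier → Matrix → Matrix
  scalar c A i j = c * A i j

  -- A real polynomial as its coefficient list [c₀, c₁, …, c_d];
  -- p(M) = c₀ I + c₁ M + … + c_d M^d, computed by Horner's rule.
  Poly : Set
  Poly = List Carrier

  evalPoly : Poly → Matrix → Matrix
  evalPoly []       M = λ _ _ → 0#
  evalPoly (c ∷ cs) M = scalar c identity ⊕ₘ (M ⊗ evalPoly cs M)

  Positive : Matrix → Set
  Positive A = ∀ i j → 0# < A i j

  AlgebraicallyPositive : Matrix → Set
  AlgebraicallyPositive M = Σ Poly λ p → Positive (evalPoly p M)

  RequiresAlgebraicPositivity : SignPattern → Set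
  RequiresAlgebraicPositivity S = ∀ X → InQ S X → AlgebraicallyPositive X

module Submission where

-- Every real matrix in Q(S₇) has the form
--
--        ⎡ 0  a  0 ⎤
--    X = ⎢ m  0  c ⎥      with a, c, d, e > 0 and m < 0.
--        ⎣ d  0  e ⎦
--
-- Writing b = -m > 0, the explicit polynomial p(t) = 3ab² + cd·t + 2b·t²
-- gives
--
--             ⎡ ab²          acd        2abc             ⎤
--    p(X) =   ⎢ bcd          ab²        c²d + 2bce       ⎥ ,
--             ⎣ cd² + 2bde   2abd       3ab² + cde + 2be² ⎦
--
-- every entry of which is a sum of products of positive numbers.  The solver
-- (which knows no negation) verifies entrywise that
-- p(X) = defect·(m + b) + closed form for an independent variable b;
-- taking b = -m kills the defect.

open import Defs
open import Level using (0ℓ)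
open import Data.Fin using (Fin; zero; suc)
open import Data.List using (List; []; _∷_)
open import Data.Product using (_,_; _×_)
open import Relation.Binary.PropositionalEquality
open import Algebra.Bundles using (CommutativeRing; CommutativeSemiring)
open import Algebra.Bundles.Raw using (RawSemiring)
open import Algebra.Structures using (IsCommutativeRing)
import Algebra.Solver.Ring.NaturalCoefficients.Default as NaturalSolver

pattern ₀ = zero
pattern ₁ = suc zero
pattern ₂ = suc (suc zero)

module Generic (R : RawSemiring 0ℓ 0ℓ) where
  open RawSemiring R renaming (Carrier to A)

  shape : (a m c d e : A) → Fin 3 → Fin 3 → A
  shape a m c d e ₀ ₀ = 0#
  shape a m c d e ₀ ₁ = a
  shape a m c d e ₀ ₂ = 0#
  shape a m c d e ₁ ₀ = m
  shape a m c d e ₁ ₁ = 0#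
  shape a m c d e ₁ ₂ = c
  shape a m c d e ₂ ₀ = d
  shape a m c d e ₂ ₁ = 0#
  shape a m c d e ₂ ₂ = e

  witness : (a b c d : A) → List A
  witness a b c d = (a * b * b + (a * b * b + a * b * b)) ∷ (c * d) ∷ (b + b) ∷ []

  -- The value of p(X) once b = -m, as displayed above.
  closedForm : (a b c d e : A) → Fin 3 → Fin 3 → A
  closedForm a b c d e ₀ ₀ = a * b * b
  closedForm a b c d e ₀ ₁ = c * d * a
  closedForm a b c d e ₀ ₂ = (b + b) * a * c
  closedForm a b c d e ₁ ₀ = b * c * d
  closedForm a b c d e ₁ ₁ = a * b * b
  closedForm a b c d e ₁ ₂ = c * d * c + (b + b) * c * e
  closedForm a b c d e ₂ ₀ = c * d * d + (b + b) * d * e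
  closedForm a b c d e ₂ ₁ = (b + b) * a * d
  closedForm a b c d e ₂ ₂ = (a * b * b + (a * b * b + a * b * b)) + c * d * e + (b + b) * e * e

  -- The coefficient of (m + b) by which p(X) differs from the closed
  -- form when b is an independent variable.
  defect : (a b c d : A) → Fin 3 → Fin 3 → A
  defect a b c d ₀ ₀ = (b + b) * a
  defect a b c d ₁ ₀ = c * d
  defect a b c d ₁ ₁ = (b + b) * a
  defect a b c d _ _ = 0#

  -- Horner evaluation of a coefficient list at a 3×3 matrix, mirroring
  -- evalPoly of Defs entry by entry.
  identityG : Fin 3 → Fin 3 → A
  identityG ₀ ₀ = 1#
  identityG ₁ ₁ = 1#
  identityG ₂ ₂ = 1#
  identityG _ _ = 0#

  evalPolyG : List A → (Fin 3 → Fin 3 → A) → Fin 3 → Fin 3 → A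
  evalPolyG []       M i j = 0#
  evalPolyG (c ∷ cs) M i j =
    c * identityG i j + (M i ₀ * evalPolyG cs M ₀ j
                      + (M i ₁ * evalPolyG cs M ₁ j + M i ₂ * evalPolyG cs M ₂ j))

module _ (ℝ : RealField) where
  open RealField ℝ
  open IsCommutativeRing isCommutativeRing
    using (+-identityˡ; -‿inverseʳ; zeroʳ)

  realRing : CommutativeRing 0ℓ 0ℓ
  realRing = record { isCommutativeRing = isCommutativeRing }

  realSemiring : CommutativeSemiring 0ℓ 0ℓ
  realSemiring = CommutativeRing.commutativeSemiring realRing

  open Generic (CommutativeSemiring.rawSemiring realSemiring)
    using (shape; witness; closedForm; defect)
  open NaturalSolver realSemiring

  +-pos : ∀ {x y} → 0# < x → 0# < y → 0# < x + y
  +-pos {x} {y} 0<x 0<y =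
    <-trans 0<y (subst (_< x + y) (+-identityˡ y) (+-mono-< y 0<x))

  neg-pos : ∀ {m} → m < 0# → 0# < - m
  neg-pos {m} m<0 = subst₂ _<_ (-‿inverseʳ m) (+-identityˡ (- m)) (+-mono-< (- m) m<0)

  defect-vanishes : ∀ p m q → p * (m + - m) + q ≡ q
  defect-vanishes p m q = begin
    p * (m + - m) + q  ≡⟨ cong (λ z → p * z + q) (-‿inverseʳ m) ⟩
    p * 0# + q         ≡⟨ cong (_+ q) (zeroʳ p) ⟩
    0# + q             ≡⟨ +-identityˡ q ⟩
    q                  ∎
    where open ≡-Reasoning

  expressions : RawSemiring 0ℓ 0ℓ
  expressions = record
    { Carrier = Polynomial 6 ; _≈_ = _≡_ ; _+_ = _:+_ ; _*_ = _:*_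
    ; 0# = con 0 ; 1# = con 1 }

  module Expr = Generic expressions

  entry-equation : Fin 3 → Fin 3 → (a m b c d e : Polynomial 6) →
                   Polynomial 6 × Polynomial 6
  entry-equation i j a m b c d e =
    Expr.evalPolyG (Expr.witness a b c d) (Expr.shape a m c d e) i j
      := Expr.defect a b c d i j :* (m :+ b) :+ Expr.closedForm a b c d e i j

  witness-at-shape : ∀ a m b c d e i j →
    evalPoly ℝ (witness a b c d) (shape a m c d e) i j
      ≡ defect a b c d i j * (m + b) + closedForm a b c d e i j
  witness-at-shape a m b c d e ₀ ₀ = solve 6 (entry-equation ₀ ₀) refl a m b c d e
  witness-at-shape a m b c d e ₀ ₁ = solve 6 (entry-equation ₀ ₁) refl a m b c d e
  witness-at-shape a m b c d e ₀ ₂ = solve 6 (entry-equation ₀ ₂) refl a m b c d e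
  witness-at-shape a m b c d e ₁ ₀ = solve 6 (entry-equation ₁ ₀) refl a m b c d e
  witness-at-shape a m b c d e ₁ ₁ = solve 6 (entry-equation ₁ ₁) refl a m b c d e
  witness-at-shape a m b c d e ₁ ₂ = solve 6 (entry-equation ₁ ₂) refl a m b c d e
  witness-at-shape a m b c d e ₂ ₀ = solve 6 (entry-equation ₂ ₀) refl a m b c d e
  witness-at-shape a m b c d e ₂ ₁ = solve 6 (entry-equation ₂ ₁) refl a m b c d e
  witness-at-shape a m b c d e ₂ ₂ = solve 6 (entry-equation ₂ ₂) refl a m b c d e

  closedForm-positive : ∀ {a b c d e} → 0# < a → 0# < b → 0# < c → 0# < d → 0# < e →
                        ∀ i j → 0# < closedForm a b c d e i j
  closedForm-positive {a} {b} {c} {d} {e} 0<a 0<b 0<c 0<d 0<e = entry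
    where
    0<2b : 0# < b + b
    0<2b = +-pos 0<b 0<b
    0<ab² : 0# < a * b * b
    0<ab² = *-pos (*-pos 0<a 0<b) 0<b
    entry : ∀ i j → 0# < closedForm a b c d e i j
    entry ₀ ₀ = 0<ab²
    entry ₀ ₁ = *-pos (*-pos 0<c 0<d) 0<a
    entry ₀ ₂ = *-pos (*-pos 0<2b 0<a) 0<c
    entry ₁ ₀ = *-pos (*-pos 0<b 0<c) 0<d
    entry ₁ ₁ = 0<ab²
    entry ₁ ₂ = +-pos (*-pos (*-pos 0<c 0<d) 0<c) (*-pos (*-pos 0<2b 0<c) 0<e)
    entry ₂ ₀ = +-pos (*-pos (*-pos 0<c 0<d) 0<d) (*-pos (*-pos 0<2b 0<d) 0<e)
    entry ₂ ₁ = *-pos (*-pos 0<2b 0<a) 0<d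
    entry ₂ ₂ = +-pos (+-pos (+-pos 0<ab² (+-pos 0<ab² 0<ab²)) (*-pos (*-pos 0<c 0<d) 0<e))
                      (*-pos (*-pos 0<2b 0<e) 0<e)

  witness-positive-at-shape : ∀ {a m c d e} →
    0# < a → m < 0# → 0# < c → 0# < d → 0# < e →
    Positive ℝ (evalPoly ℝ (witness a (- m) c d) (shape a m c d e))
  witness-positive-at-shape {a} {m} {c} {d} {e} 0<a m<0 0<c 0<d 0<e i j =
    subst (0# <_)
      (sym (trans (witness-at-shape a m (- m) c d e i j)
                  (defect-vanishes (defect a (- m) c d i j) m _)))
      (closedForm-positive 0<a (neg-pos m<0) 0<c 0<d 0<e i j)

  evalPoly-cong : ∀ {X Y : Matrix ℝ} → (∀ i j → X i j ≡ Y i j) →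
                  ∀ p i j → evalPoly ℝ p X i j ≡ evalPoly ℝ p Y i j
  evalPoly-cong X≡Y []       i j = refl
  evalPoly-cong X≡Y (c ∷ cs) i j = cong (c * identity ℝ i j +_)
    (cong₂ _+_ (cong₂ _*_ (X≡Y i ₀) (evalPoly-cong X≡Y cs ₀ j))
      (cong₂ _+_ (cong₂ _*_ (X≡Y i ₁) (evalPoly-cong X≡Y cs ₁ j))
                 (cong₂ _*_ (X≡Y i ₂) (evalPoly-cong X≡Y cs ₂ j))))

  inQ⇒shape : ∀ X → InQ ℝ S₇ X → ∀ i j → X i j ≡ shape (X ₀ ₁) (X ₁ ₀) (X ₁ ₂) (X ₂ ₀) (X ₂ ₂) i j
  inQ⇒shape X X∈Q ₀ ₀ = X∈Q ₀ ₀
  inQ⇒shape X X∈Q ₀ ₁ = refl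
  inQ⇒shape X X∈Q ₀ ₂ = X∈Q ₀ ₂
  inQ⇒shape X X∈Q ₁ ₀ = refl
  inQ⇒shape X X∈Q ₁ ₁ = X∈Q ₁ ₁
  inQ⇒shape X X∈Q ₁ ₂ = refl
  inQ⇒shape X X∈Q ₂ ₀ = refl
  inQ⇒shape X X∈Q ₂ ₁ = X∈Q ₂ ₁
  inQ⇒shape X X∈Q ₂ ₂ = refl

  S₇-requiresAlgebraicPositivity : RequiresAlgebraicPositivity ℝ S₇
  S₇-requiresAlgebraicPositivity X X∈Q = p , p-positive
    where
    p : Poly ℝ
    p = witness (X ₀ ₁) (- X ₁ ₀) (X ₁ ₂) (X ₂ ₀)
    p-positive : Positive ℝ (evalPoly ℝ p X)
    p-positive i j =
      subst (0# <_) (sym (evalPoly-cong (inQ⇒shape X X∈Q) p i j))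
        (witness-positive-at-shape (X∈Q ₀ ₁) (X∈Q ₁ ₀) (X∈Q ₁ ₂) (X∈Q ₂ ₀) (X∈Q ₂ ₂) i j)

mainTheorem7 : (ℝ : RealField) → RequiresAlgebraicPositivity ℝ S₇
mainTheorem7 = S₇-requiresAlgebraicPositivity
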